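{- Let $\Delta$ be a lexicographically shellable $q$-complex on $\mathbb{F}_q^n$ of dimension $r$. Let $\{U_0\subset U_1\subset\cdots\subset U_t\}$ be a chain in $\Delta$ with $U_0=\{0\}$ and $\dim U_i=i$ for all $i$. If $U_{t-1}$ contains the minimum nonzero vector of $U_t$, then there is some $1\le s<t$ with $$U_s=\min_{\prec_q}\{A:\ U_{s-1}\subset A\subset U_{s+1},\ \dim A=s\}.$$
   Context: Let $q$ be a prime power. Fix a total order $\prec$ on $\mathbb{F}_q$ with $0\prec1\prec x$ for all $x\in\mathbb{F}_q\setminus\{0,1\}$, extended lexicographically to $\mathbb{F}_q^n$; minima of sets of vectors are with respect to $\prec$. For distinct subspaces $U,V$ of the same dimension, $U\prec_q V$ iff $\min(U\setminus V)\prec\min(V\setminus U)$. A $q$-complex on $\mathbb{F}_q^n$ is a set of subspaces closed under taking subspaces; facets are maximal elements. It is lexicographically shellable if all facets have the same dimension $r$ and, with facets listed $F_1\prec_q\cdots\prec_q F_t$, for all $i<j$ there is $m<j$ with $F_i\cap F_j\subseteq F_m\cap F_j$ and $\dim(F_m\cap F_j)=r-1$. -}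

module Defs where

open import Level using (0ℓ)
open import Data.Nat using (ℕ; zero; suc; _∸_; _≤_; _<_; _^_)
open import Data.Nat.Primality using (Prime)
open import Data.Fin using (Fin)
import Data.Fin as Fin
open import Data.Vec using (Vec; []; _∷_; zipWith; replicate; map)
open import Data.Product using (Σ; ∃; ∃-syntax; _×_; _,_)
open import Data.Sum using (_⊎_)
open import Data.Empty using (⊥)
open import Relation.Nullary using (¬_)
open import Relation.Binary.PropositionalEquality using (_≡_; _≢_)
open import Relation.Binary.Structures using (IsStrictTotalOrder)
open import Relation.Binary.Definitions using (DecidableEquality)
open import Algebra.Structures using (IsCommutativeRing)
open import Function.Bundles using (_↔_)

record FiniteField : Set₁ where
  infixl 6 _+_
  infixl 7 _*_
  field
    Carrier : Set
    _+_ _*_ : Carrier → Carrier → Carrier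
    -_      : Carrier → Carrier
    0# 1#   : Carrier
    isCommutativeRing : IsCommutativeRing _≡_ _+_ _*_ -_ 0# 1#
    0≢1     : 0# ≢ 1#
    inverse : ∀ x → x ≢ 0# → ∃[ y ] (x * y ≡ 1#)
    _≟_     : DecidableEquality Carrier
    q       : ℕ
    p k     : ℕ
    p-prime : Prime p
    q≡p^k   : q ≡ p ^ suc k
    enum    : Carrier ↔ Fin q

record FieldOrder (F : FiniteField) : Set₁ where
  open FiniteField F
  field
    _≺_ : Carrier → Carrier → Set
    isStrictTotalOrder : IsStrictTotalOrder _≡_ _≺_
    0≺1 : 0# ≺ 1#
    1≺x : ∀ x → x ≢ 0# → x ≢ 1# → 1# ≺ x

module Setup (F : FiniteField) (O : FieldOrder F) (n : ℕ) where
  open FiniteField F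
  open FieldOrder O

  V : Set
  V = Vec Carrier n

  zeroV : V
  zeroV = replicate n 0#

  _⊕_ : V → V → V
  _⊕_ = zipWith _+_

  _·_ : Carrier → V → V
  c · v = map (c *_) v

  data Lex : ∀ {m} → Vec Carrier m → Vec Carrier m → Set where
    here  : ∀ {m x y} {xs ys : Vec Carrier m} → x ≺ y → Lex (x ∷ xs) (y ∷ ys)
    there : ∀ {m x} {xs ys : Vec Carrier m} → Lex xs ys → Lex (x ∷ xs) (x ∷ ys)

  IsMinVec : V → (V → Set) → Set
  IsMinVec x S = S x × (∀ y → S y → y ≡ x ⊎ Lex x y)

  record Subspace : Set₁ where
    field
      mem      : V → Set
      mem-0    : mem zeroV
      mem-⊕    : ∀ {u v} → mem u → mem v → mem (u ⊕ v)
      mem-·    : ∀ c {v} → mem v → mem (c · v)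
  open Subspace public

  _⊆_ : Subspace → Subspace → Set
  U ⊆ W = ∀ v → mem U v → mem W v

  _≐_ : Subspace → Subspace → Set
  U ≐ W = U ⊆ W × W ⊆ U

  _∩_ : Subspace → Subspace → Subspace
  U ∩ W = record
    { mem   = λ v → mem U v × mem W v
    ; mem-0 = mem-0 U , mem-0 W
    ; mem-⊕ = λ { (a , b) (c , d) → mem-⊕ U a c , mem-⊕ W b d }
    ; mem-· = λ c → λ { (a , b) → mem-· U c a , mem-· W c b }
    }

  lincomb : ∀ {d} → (Fin d → Carrier) → (Fin d → V) → V
  lincomb {zero}  c b = zeroV
  lincomb {suc d} c b = (c Fin.zero · b Fin.zero) ⊕ lincomb (λ i → c (Fin.suc i)) (λ i → b (Fin.suc i))

  HasDim : Subspace → ℕ → Set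
  HasDim U d = Σ (Fin d → V) λ b →
      (∀ i → mem U (b i))
    × (∀ (c : Fin d → Carrier) → lincomb c b ≡ zeroV → ∀ i → c i ≡ 0#)
    × (∀ v → mem U v → ∃[ c ] (v ≡ lincomb c b))

  _≺q_ : Subspace → Subspace → Set
  U ≺q W = ∃[ x ] ∃[ y ]
      IsMinVec x (λ v → mem U v × ¬ mem W v)
    × IsMinVec y (λ v → mem W v × ¬ mem U v)
    × Lex x y

  IsMinSub : Subspace → (Subspace → Set) → Set₁
  IsMinSub A S = S A × (∀ B → S B → A ≐ B ⊎ A ≺q B)

  record QComplex : Set₂ where
    field
      face   : Subspace → Set
      closed : ∀ U W → face W → U ⊆ W → face U
  open QComplex public

  IsFacet : QComplex → Subspace → Set₁
  IsFacet Δ F = face Δ F × (∀ G → face Δ G → F ⊆ G → G ⊆ F)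

  -- Lexicographic shellability with all facets of dimension r.
  -- (Listing facets F_1 ≺_q ... ≺_q F_t, "i < j" means F_i ≺_q F_j.)
  LexShellable : QComplex → ℕ → Set₁
  LexShellable Δ r =
      (∀ F → IsFacet Δ F → HasDim F r)
    × (∀ F G → IsFacet Δ F → IsFacet Δ G → F ≺q G →
         Σ Subspace λ H → IsFacet Δ H × H ≺q G
           × (F ∩ G) ⊆ (H ∩ G) × HasDim (H ∩ G) (r ∸ 1))

-- Let v be the minimum nonzero vector of U t and s the first index with v ∈ U s; since
-- v ∈ U (t ∸ 1) we get 1 ≤ s < t. Every s-dimensional A between U (s ∸ 1) and U (suc s)
-- either contains v, and then equals U (s ∸ 1) + ⟨v⟩ = U s, or it does not, and then
-- min (U s ∖ A) = v while min (A ∖ U s) is another nonzero vector of U t, hence above v.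
-- The only linear algebra needed is that d independent vectors of a d-dimensional space
-- span it, which over a finite field follows by counting coefficient vectors.
module Submission where

open import Defs
open import Level using (0ℓ)
open import Data.Nat using (ℕ; zero; suc; _∸_; _≤_; _<_; z≤n; s≤s; _^_)
import Data.Nat.Properties as ℕ
open import Data.Fin using (Fin; funToFin; finToFun; combine; punchOut)
import Data.Fin as Fin
import Data.Fin.Properties as Fin
open import Data.Vec using (Vec; []; _∷_; zipWith; replicate; map; tabulate; lookup)
import Data.Vec.Functional as Vector
open import Data.Vec.Properties
  using (≡-dec; tabulate-cong; tabulate∘lookup; zipWith-assoc; zipWith-identityˡ; zipWith-identityʳ)
open import Data.Product using (∃-syntax; _×_; _,_; proj₁; proj₂)
open import Data.Sum using (_⊎_; inj₁; inj₂)
open import Data.Empty using (⊥-elim)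
open import Relation.Nullary using (¬_; Dec; yes; no)
open import Relation.Nullary.Decidable using (_×-dec_; ¬?)
open import Relation.Binary.PropositionalEquality
  using (_≡_; _≢_; refl; sym; trans; cong; cong₂; subst; module ≡-Reasoning)
open import Relation.Binary.Structures using (IsStrictTotalOrder)
open import Relation.Binary.Definitions using (tri<; tri≈; tri>)
open import Algebra.Bundles using (CommutativeRing)
open import Function.Bundles using (Inverse)

first-entry : ∀ (P : ℕ → Set) k → (∀ i → i < k → Dec (P i)) → ¬ P 0 → P k →
              ∃[ s ] (s < k × ¬ P s × P (suc s))
first-entry P zero    P? ¬P0 Pk = ⊥-elim (¬P0 Pk)
first-entry P (suc k) P? ¬P0 Pk with P? k ℕ.≤-refl
... | no ¬Pk = k , ℕ.≤-refl , ¬Pk , Pk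
... | yes Pk′ with s , s<k , ¬Ps , Ps₁ ← first-entry P k (λ i i<k → P? i (ℕ.m≤n⇒m≤1+n i<k)) ¬P0 Pk′
      = s , ℕ.m≤n⇒m≤1+n s<k , ¬Ps , Ps₁

injective⇒surjective : ∀ {N} (g : Fin N → Fin N) → (∀ i j → g i ≡ g j → i ≡ j) →
                       ∀ y → ∃[ i ] g i ≡ y
injective⇒surjective {zero}  g inj ()
injective⇒surjective {suc N} g inj y with Fin.any? (λ i → g i Fin.≟ y)
... | yes found = found
... | no  ¬hit  = ⊥-elim (ℕ.1+n≰n (Fin.injective⇒≤ {f = g∖y} g∖y-injective))
  where
  g∖y : Fin (suc N) → Fin N
  g∖y i = punchOut {i = y} {j = g i} (λ e → ¬hit (i , sym e))
  g∖y-injective : ∀ {i j} → g∖y i ≡ g∖y j → i ≡ j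
  g∖y-injective {i} {j} e =
    inj i j (Fin.punchOut-injective (λ e′ → ¬hit (i , sym e′)) (λ e′ → ¬hit (j , sym e′)) e)

module _ (F : FiniteField) (O : FieldOrder F) (n : ℕ) where
  open FiniteField F
  open FieldOrder O
  open Setup F O n
  open ≡-Reasoning

  private
    ring : CommutativeRing 0ℓ 0ℓ
    ring = record
      { Carrier = Carrier ; _≈_ = _≡_ ; _+_ = _+_ ; _*_ = _*_ ; -_ = -_
      ; 0# = 0# ; 1# = 1# ; isCommutativeRing = isCommutativeRing }
    module R = CommutativeRing ring
    module STO = IsStrictTotalOrder isStrictTotalOrder

  open import Algebra.Properties.Ring R.ring using (-1*x≈-x)
  open import Algebra.Properties.Group R.+-group using (x∙y⁻¹≈ε⇒x≈y)
  open import Algebra.Properties.CommutativeSemigroup R.+-commutativeSemigroup using (interchange)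

  x+-1*x≡0 : ∀ x → x + (- 1#) * x ≡ 0#
  x+-1*x≡0 x = trans (cong (x +_) (-1*x≈-x x)) (R.-‿inverseʳ x)

  x+-1*y≡0⇒x≡y : ∀ x y → x + (- 1#) * y ≡ 0# → x ≡ y
  x+-1*y≡0⇒x≡y x y e = x∙y⁻¹≈ε⇒x≈y x y (trans (cong (x +_) (sym (-1*x≈-x y))) e)

  ⊕-assoc : ∀ {m} (u v w : Vec Carrier m) →
            zipWith _+_ (zipWith _+_ u v) w ≡ zipWith _+_ u (zipWith _+_ v w)
  ⊕-assoc = zipWith-assoc R.+-assoc

  ⊕-identityˡ : ∀ {m} (v : Vec Carrier m) → zipWith _+_ (replicate m 0#) v ≡ v
  ⊕-identityˡ = zipWith-identityˡ R.+-identityˡ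

  ⊕-identityʳ : ∀ {m} (v : Vec Carrier m) → zipWith _+_ v (replicate m 0#) ≡ v
  ⊕-identityʳ = zipWith-identityʳ R.+-identityʳ

  ⊕-interchange : ∀ {m} (a b c d : Vec Carrier m) →
    zipWith _+_ (zipWith _+_ a b) (zipWith _+_ c d) ≡ zipWith _+_ (zipWith _+_ a c) (zipWith _+_ b d)
  ⊕-interchange []       []       []       []       = refl
  ⊕-interchange (a ∷ as) (b ∷ bs) (c ∷ cs) (d ∷ ds) = cong₂ _∷_ (interchange a b c d) (⊕-interchange as bs cs ds)

  ⊕-inverseʳ : ∀ {m} (v : Vec Carrier m) → zipWith _+_ v (map ((- 1#) *_) v) ≡ replicate m 0#
  ⊕-inverseʳ []      = refl
  ⊕-inverseʳ (x ∷ v) = cong₂ _∷_ (x+-1*x≡0 x) (⊕-inverseʳ v)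

  ·-distribˡ : ∀ {m} c (u v : Vec Carrier m) → map (c *_) (zipWith _+_ u v) ≡ zipWith _+_ (map (c *_) u) (map (c *_) v)
  ·-distribˡ c []      []      = refl
  ·-distribˡ c (a ∷ u) (b ∷ v) = cong₂ _∷_ (R.distribˡ c a b) (·-distribˡ c u v)

  ·-distribʳ : ∀ {m} a b (v : Vec Carrier m) → map ((a + b) *_) v ≡ zipWith _+_ (map (a *_) v) (map (b *_) v)
  ·-distribʳ a b []      = refl
  ·-distribʳ a b (x ∷ v) = cong₂ _∷_ (R.distribʳ x a b) (·-distribʳ a b v)

  ·-assoc : ∀ {m} a b (v : Vec Carrier m) → map ((a * b) *_) v ≡ map (a *_) (map (b *_) v)
  ·-assoc a b []      = refl
  ·-assoc a b (x ∷ v) = cong₂ _∷_ (R.*-assoc a b x) (·-assoc a b v)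

  ·-identityˡ : ∀ {m} (v : Vec Carrier m) → map (1# *_) v ≡ v
  ·-identityˡ []      = refl
  ·-identityˡ (x ∷ v) = cong₂ _∷_ (R.*-identityˡ x) (·-identityˡ v)

  ·-zeroˡ : ∀ {m} (v : Vec Carrier m) → map (0# *_) v ≡ replicate m 0#
  ·-zeroˡ []      = refl
  ·-zeroˡ (x ∷ v) = cong₂ _∷_ (R.zeroˡ x) (·-zeroˡ v)

  ·-zeroʳ : ∀ m c → map (c *_) (replicate m 0#) ≡ replicate m 0#
  ·-zeroʳ zero    c = refl
  ·-zeroʳ (suc m) c = cong₂ _∷_ (R.zeroʳ c) (·-zeroʳ m c)

  ⊕≡0⇒≡-1· : ∀ (a b : V) → a ⊕ b ≡ zeroV → a ≡ (- 1#) · b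
  ⊕≡0⇒≡-1· a b e = begin
    a                                ≡⟨ sym (⊕-identityʳ a) ⟩
    a ⊕ zeroV                        ≡⟨ cong (a ⊕_) (sym (⊕-inverseʳ b)) ⟩
    a ⊕ (b ⊕ ((- 1#) · b))           ≡⟨ sym (⊕-assoc a b _) ⟩
    (a ⊕ b) ⊕ ((- 1#) · b)           ≡⟨ cong (_⊕ ((- 1#) · b)) e ⟩
    zeroV ⊕ ((- 1#) · b)             ≡⟨ ⊕-identityˡ _ ⟩
    (- 1#) · b                       ∎

  Independent : ∀ {d} → (Fin d → V) → Set
  Independent b = ∀ c → lincomb c b ≡ zeroV → ∀ i → c i ≡ 0#

  lincomb-cong : ∀ {d} {c c′ : Fin d → Carrier} (b : Fin d → V) →
                 (∀ i → c i ≡ c′ i) → lincomb c b ≡ lincomb c′ b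
  lincomb-cong {zero}  b c≗c′ = refl
  lincomb-cong {suc d} b c≗c′ =
    cong₂ _⊕_ (cong (_· b Fin.zero) (c≗c′ Fin.zero)) (lincomb-cong (λ i → b (Fin.suc i)) (λ i → c≗c′ (Fin.suc i)))

  lincomb-+ : ∀ {d} (c c′ : Fin d → Carrier) (b : Fin d → V) →
              lincomb (λ i → c i + c′ i) b ≡ lincomb c b ⊕ lincomb c′ b
  lincomb-+ {zero}  c c′ b = sym (⊕-identityˡ zeroV)
  lincomb-+ {suc d} c c′ b = begin
    ((c₀ + c′₀) · b₀) ⊕ lincomb (λ i → c (Fin.suc i) + c′ (Fin.suc i)) b₊
      ≡⟨ cong₂ _⊕_ (·-distribʳ c₀ c′₀ b₀) (lincomb-+ (λ i → c (Fin.suc i)) (λ i → c′ (Fin.suc i)) b₊) ⟩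
    ((c₀ · b₀) ⊕ (c′₀ · b₀)) ⊕ (lincomb (λ i → c (Fin.suc i)) b₊ ⊕ lincomb (λ i → c′ (Fin.suc i)) b₊)
      ≡⟨ ⊕-interchange _ _ _ _ ⟩
    lincomb c b ⊕ lincomb c′ b ∎
    where
    c₀ = c Fin.zero ; c′₀ = c′ Fin.zero ; b₀ = b Fin.zero
    b₊ = λ i → b (Fin.suc i)

  lincomb-* : ∀ {d} a (c : Fin d → Carrier) (b : Fin d → V) →
              lincomb (λ i → a * c i) b ≡ a · lincomb c b
  lincomb-* {zero}  a c b = sym (·-zeroʳ n a)
  lincomb-* {suc d} a c b = begin
    ((a * c Fin.zero) · b Fin.zero) ⊕ lincomb (λ i → a * c (Fin.suc i)) b₊
      ≡⟨ cong₂ _⊕_ (·-assoc a (c Fin.zero) (b Fin.zero)) (lincomb-* a (λ i → c (Fin.suc i)) b₊) ⟩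
    (a · (c Fin.zero · b Fin.zero)) ⊕ (a · lincomb (λ i → c (Fin.suc i)) b₊)
      ≡⟨ sym (·-distribˡ a _ _) ⟩
    a · lincomb c b ∎
    where b₊ = λ i → b (Fin.suc i)

  lincomb-mem : ∀ (U : Subspace) {d} (b : Fin d → V) → (∀ i → mem U (b i)) → ∀ c → mem U (lincomb c b)
  lincomb-mem U {zero}  b b∈U c = mem-0 U
  lincomb-mem U {suc d} b b∈U c = mem-⊕ U (mem-· U (c Fin.zero) (b∈U Fin.zero))
    (lincomb-mem U (λ i → b (Fin.suc i)) (λ i → b∈U (Fin.suc i)) (λ i → c (Fin.suc i)))

  lincomb-injective : ∀ {d} (b : Fin d → V) → Independent b →
                      ∀ c c′ → lincomb c b ≡ lincomb c′ b → ∀ i → c i ≡ c′ i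
  lincomb-injective b indep c c′ e i = x+-1*y≡0⇒x≡y (c i) (c′ i) (indep _ difference≡0 i)
    where
    difference≡0 : lincomb (λ i → c i + (- 1#) * c′ i) b ≡ zeroV
    difference≡0 = begin
      lincomb (λ i → c i + (- 1#) * c′ i) b       ≡⟨ lincomb-+ c _ b ⟩
      lincomb c b ⊕ lincomb (λ i → (- 1#) * c′ i) b ≡⟨ cong (lincomb c b ⊕_) (lincomb-* (- 1#) c′ b) ⟩
      lincomb c b ⊕ ((- 1#) · lincomb c′ b)       ≡⟨ cong (λ w → lincomb c b ⊕ ((- 1#) · w)) (sym e) ⟩
      lincomb c b ⊕ ((- 1#) · lincomb c b)        ≡⟨ ⊕-inverseʳ _ ⟩
      zeroV                                       ∎

  independent-cons : ∀ (X : Subspace) {d} (b : Fin d → V) → (∀ i → mem X (b i)) → Independent b →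
                     ∀ v → ¬ mem X v → Independent (v Vector.∷ b)
  independent-cons X b b∈X indep v v∉X c e with c Fin.zero ≟ 0#
  ... | yes c₀≡0 = λ { Fin.zero → c₀≡0 ; (Fin.suc i) → indep c₊ tail≡0 i }
    where
    c₊ = λ i → c (Fin.suc i)
    tail≡0 : lincomb c₊ b ≡ zeroV
    tail≡0 = begin
      lincomb c₊ b                          ≡⟨ sym (⊕-identityˡ _) ⟩
      zeroV ⊕ lincomb c₊ b                  ≡⟨ cong (_⊕ lincomb c₊ b) (sym (trans (cong (_· v) c₀≡0) (·-zeroˡ v))) ⟩
      (c Fin.zero · v) ⊕ lincomb c₊ b       ≡⟨ e ⟩
      zeroV                                 ∎
  ... | no c₀≢0 = ⊥-elim (v∉X (subst (mem X) (sym v≡) (mem-· X y (mem-· X (- 1#) tail∈X))))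
    where
    c₀ = c Fin.zero
    y = proj₁ (inverse c₀ c₀≢0)
    tail∈X = lincomb-mem X b b∈X (λ i → c (Fin.suc i))
    v≡ : v ≡ y · ((- 1#) · lincomb (λ i → c (Fin.suc i)) b)
    v≡ = begin
      v                  ≡⟨ sym (·-identityˡ v) ⟩
      1# · v             ≡⟨ cong (_· v) (sym (trans (R.*-comm y c₀) (proj₂ (inverse c₀ c₀≢0)))) ⟩
      (y * c₀) · v       ≡⟨ ·-assoc y c₀ v ⟩
      y · (c₀ · v)       ≡⟨ cong (y ·_) (⊕≡0⇒≡-1· _ _ e) ⟩
      y · ((- 1#) · lincomb (λ i → c (Fin.suc i)) b) ∎

  -- Coefficient functions Fin d → F_q are encoded as elements of Fin (q ^ d); without
  -- function extensionality they are only ever compared pointwise.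

  private module E = Inverse enum

  encode : ∀ {d} → (Fin d → Carrier) → Fin (q ^ d)
  encode c = funToFin (λ i → E.to (c i))

  decode : ∀ {d} → Fin (q ^ d) → Fin d → Carrier
  decode k j = E.from (finToFun k j)

  funToFin-cong : ∀ {d} {f g : Fin d → Fin q} → (∀ i → f i ≡ g i) → funToFin f ≡ funToFin g
  funToFin-cong {zero}  f≗g = refl
  funToFin-cong {suc d} f≗g = cong₂ combine (f≗g Fin.zero) (funToFin-cong (λ i → f≗g (Fin.suc i)))

  decode-encode : ∀ {d} (c : Fin d → Carrier) j → decode (encode c) j ≡ c j
  decode-encode c j = trans (cong E.from (Fin.finToFun-funToFin (λ i → E.to (c i)) j)) (E.strictlyInverseʳ (c j))

  encode-decode : ∀ {d} (k : Fin (q ^ d)) → encode {d} (decode {d} k) ≡ k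
  encode-decode {d} k =
    trans (funToFin-cong {d} (λ j → E.strictlyInverseˡ (finToFun k j))) (Fin.funToFin-finToFin {d} {q} k)

  encode-injective : ∀ {d} (c c′ : Fin d → Carrier) → encode c ≡ encode c′ → ∀ j → c j ≡ c′ j
  encode-injective c c′ e j = trans (sym (decode-encode c j)) (trans (cong (λ k → decode k j) e) (decode-encode c′ j))

  mem-dec : ∀ (U : Subspace) {d} → HasDim U d → ∀ w → Dec (mem U w)
  mem-dec U {d} (b , b∈U , _ , spans) w with Fin.any? (λ k → ≡-dec _≟_ w (lincomb (decode {d} k) b))
  ... | yes (k , e) = yes (subst (mem U) (sym e) (lincomb-mem U b b∈U (decode k)))
  ... | no  ¬found  = no λ w∈U → let (c , w≡) = spans w w∈U in
        ¬found (encode c , trans w≡ (lincomb-cong b (λ j → sym (decode-encode c j))))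

  -- Over a finite field, c ↦ (coordinates of Σ c_i b_i in a basis of B) is an injective
  -- self-map of a finite set of size q ^ d, hence onto.
  independent-spans : ∀ (B : Subspace) {d} → HasDim B d → (b : Fin d → V) → (∀ i → mem B (b i)) →
                      Independent b → ∀ w → mem B w → ∃[ c ] (w ≡ lincomb c b)
  independent-spans B {d} (e , _ , _ , spans) b b∈B indep w w∈B = decode preimage , w≡
    where
    coords : (Fin d → Carrier) → Fin d → Carrier
    coords c = proj₁ (spans (lincomb c b) (lincomb-mem B b b∈B c))
    coords-spec : ∀ c → lincomb c b ≡ lincomb (coords c) e
    coords-spec c = proj₂ (spans (lincomb c b) (lincomb-mem B b b∈B c))
    g : Fin (q ^ d) → Fin (q ^ d)
    g k = encode (coords (decode {d} k))
    g-injective : ∀ k l → g k ≡ g l → k ≡ l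
    g-injective k l gk≡gl = begin
      k                         ≡⟨ sym (encode-decode {d} k) ⟩
      encode (decode {d} k)     ≡⟨ funToFin-cong (λ j → cong E.to (lincomb-injective b indep _ _ same j)) ⟩
      encode (decode {d} l)     ≡⟨ encode-decode {d} l ⟩
      l                         ∎
      where
      same : lincomb (decode {d} k) b ≡ lincomb (decode {d} l) b
      same = trans (coords-spec _) (trans (lincomb-cong e (encode-injective _ _ gk≡gl)) (sym (coords-spec _)))
    cw = proj₁ (spans w w∈B)
    hit = injective⇒surjective g g-injective (encode cw)
    preimage = proj₁ hit
    w≡ : w ≡ lincomb (decode {d} preimage) b
    w≡ = trans (proj₂ (spans w w∈B))
           (trans (lincomb-cong e (λ j → sym (encode-injective _ _ (proj₂ hit) j))) (sym (coords-spec _)))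

  independent⇒⊆ : ∀ (A B : Subspace) {d} → HasDim A d → (b : Fin d → V) → (∀ i → mem A (b i)) →
                  Independent b → (∀ i → mem B (b i)) → A ⊆ B
  independent⇒⊆ A B dimA b b∈A indep b∈B w w∈A with c , w≡ ← independent-spans A dimA b b∈A indep w w∈A
    = subst (mem B) (sym w≡) (lincomb-mem B b b∈B c)

  ⊆-sameDim⇒⊇ : ∀ (A B : Subspace) {d} → HasDim A d → HasDim B d → A ⊆ B → B ⊆ A
  ⊆-sameDim⇒⊇ A B (a , a∈A , indep , _) dimB A⊆B =
    independent⇒⊆ B A dimB a (λ i → A⊆B (a i) (a∈A i)) indep a∈A

  Lex-trans : ∀ {m} {a b c : Vec Carrier m} → Lex a b → Lex b c → Lex a c
  Lex-trans (here p)  (here p′)  = here (STO.trans p p′)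
  Lex-trans (here p)  (there l)  = here p
  Lex-trans (there l) (here p)   = here p
  Lex-trans (there l) (there l′) = there (Lex-trans l l′)

  Lex-compare : ∀ {m} (a b : Vec Carrier m) → Lex a b ⊎ (a ≡ b ⊎ Lex b a)
  Lex-compare []       []       = inj₂ (inj₁ refl)
  Lex-compare (x ∷ xs) (y ∷ ys) with STO.compare x y
  ... | tri< x≺y _ _ = inj₁ (here x≺y)
  ... | tri> _ _ y≺x = inj₂ (inj₂ (here y≺x))
  ... | tri≈ _ refl _ with Lex-compare xs ys
  ...   | inj₁ l          = inj₁ (there l)
  ...   | inj₂ (inj₁ refl) = inj₂ (inj₁ refl)
  ...   | inj₂ (inj₂ l)   = inj₂ (inj₂ (there l))

  min-over : ∀ {N} (f : Fin N → V) (P : V → Set) → (∀ x → Dec (P x)) →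
             (∀ i → ¬ P (f i)) ⊎ ∃[ x ] (P x × (∀ i → P (f i) → f i ≡ x ⊎ Lex x (f i)))
  min-over {zero}  f P P? = inj₁ λ ()
  min-over {suc N} f P P? with P? (f Fin.zero) | min-over (λ i → f (Fin.suc i)) P P?
  ... | no ¬P₀ | inj₁ none = inj₁ λ { Fin.zero → ¬P₀ ; (Fin.suc i) → none i }
  ... | no ¬P₀ | inj₂ (x , Px , least) =
        inj₂ (x , Px , λ { Fin.zero P₀ → ⊥-elim (¬P₀ P₀) ; (Fin.suc i) → least i })
  ... | yes P₀ | inj₁ none =
        inj₂ (f Fin.zero , P₀ , λ { Fin.zero _ → inj₁ refl ; (Fin.suc i) Pi → ⊥-elim (none i Pi) })
  ... | yes P₀ | inj₂ (x , Px , least) with Lex-compare (f Fin.zero) x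
  ...   | inj₂ (inj₁ f₀≡x) = inj₂ (x , Px , λ { Fin.zero _ → inj₁ f₀≡x ; (Fin.suc i) → least i })
  ...   | inj₂ (inj₂ x<f₀) = inj₂ (x , Px , λ { Fin.zero _ → inj₂ x<f₀ ; (Fin.suc i) → least i })
  ...   | inj₁ f₀<x = inj₂ (f Fin.zero , P₀ , λ { Fin.zero _ → inj₁ refl ; (Fin.suc i) Pi → below (least i Pi) })
    where
    below : ∀ {y} → y ≡ x ⊎ Lex x y → y ≡ f Fin.zero ⊎ Lex (f Fin.zero) y
    below (inj₁ refl) = inj₂ f₀<x
    below (inj₂ x<y)  = inj₂ (Lex-trans f₀<x x<y)

  vectorAt : Fin (q ^ n) → V
  vectorAt k = tabulate (decode k)

  vectorAt-encode : ∀ w → vectorAt (encode (lookup w)) ≡ w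
  vectorAt-encode w = trans (tabulate-cong (decode-encode (lookup w))) (tabulate∘lookup w)

  minVec : (P : V → Set) → (∀ x → Dec (P x)) → (∀ w → ¬ P w) ⊎ ∃[ x ] IsMinVec x P
  minVec P P? with min-over vectorAt P P?
  ... | inj₁ none = inj₁ λ w Pw → none (encode (lookup w)) (subst P (sym (vectorAt-encode w)) Pw)
  ... | inj₂ (x , Px , least) = inj₂ (x , Px , λ w Pw → subst (λ z → z ≡ x ⊎ Lex x z) (vectorAt-encode w)
          (least (encode (lookup w)) (subst P (sym (vectorAt-encode w)) Pw)))

  chain-⊆ : ∀ (U : ℕ → Subspace) {i} t → (∀ j → j < t → U j ⊆ U (suc j)) → i ≤ t → U i ⊆ U t
  chain-⊆ U zero    step z≤n w w∈Ui = w∈Ui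
  chain-⊆ U (suc t) step i≤t+1 w w∈Ui with ℕ.m≤n⇒m<n∨m≡n i≤t+1
  ... | inj₂ refl        = w∈Ui
  ... | inj₁ (s≤s i≤t) = step t ℕ.≤-refl w (chain-⊆ U t (λ j j<t → step j (ℕ.m≤n⇒m≤1+n j<t)) i≤t w w∈Ui)

  ∉⇒≢0 : ∀ (A : Subspace) {w} → ¬ mem A w → w ≢ zeroV
  ∉⇒≢0 A w∉A refl = w∉A (mem-0 A)

  flag-step-isMin : ∀ (X S Y W : Subspace) {d} → HasDim X d → HasDim S (suc d) →
    X ⊆ S → S ⊆ Y → Y ⊆ W →
    ∀ v → IsMinVec v (λ w → mem W w × w ≢ zeroV) → mem S v → ¬ mem X v →
    IsMinSub S (λ A → X ⊆ A × A ⊆ Y × HasDim A (suc d))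
  flag-step-isMin X S Y W {d} (b , b∈X , b-indep , _) dimS X⊆S S⊆Y Y⊆W v (_ , v-least) v∈S v∉X =
    (X⊆S , S⊆Y , dimS) , compare-with
    where
    v∷b∈ : ∀ A → X ⊆ A → mem A v → ∀ i → mem A ((v Vector.∷ b) i)
    v∷b∈ A X⊆A v∈A Fin.zero    = v∈A
    v∷b∈ A X⊆A v∈A (Fin.suc i) = X⊆A (b i) (b∈X i)

    compare-with : ∀ B → X ⊆ B × B ⊆ Y × HasDim B (suc d) → S ≐ B ⊎ S ≺q B
    compare-with B (X⊆B , B⊆Y , dimB) with mem-dec B dimB v
    ... | yes v∈B = inj₁ (S⊆B , ⊆-sameDim⇒⊇ S B dimS dimB S⊆B)
      where
      S⊆B : S ⊆ B
      S⊆B = independent⇒⊆ S B dimS (v Vector.∷ b) (v∷b∈ S X⊆S v∈S)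
              (independent-cons X b b∈X b-indep v v∉X) (v∷b∈ B X⊆B v∈B)
    ... | no v∉B with minVec (λ w → mem B w × ¬ mem S w) (λ w → mem-dec B dimB w ×-dec ¬? (mem-dec S dimS w))
    ...   | inj₁ B∖S≡∅ = ⊥-elim (v∉B (⊆-sameDim⇒⊇ B S dimB dimS B⊆S v v∈S))
      where
      B⊆S : B ⊆ S
      B⊆S w w∈B with mem-dec S dimS w
      ... | yes w∈S = w∈S
      ... | no  w∉S = ⊥-elim (B∖S≡∅ w (w∈B , w∉S))
    ...   | inj₂ (y , y-min@((y∈B , y∉S) , _)) = inj₂ (v , y , v-min , y-min , v<y)
      where
      v-min : IsMinVec v (λ w → mem S w × ¬ mem B w)
      v-min = (v∈S , v∉B) , λ w (w∈S , w∉B) → v-least w (Y⊆W w (S⊆Y w w∈S) , ∉⇒≢0 B w∉B)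
      v<y : Lex v y
      v<y with v-least y (Y⊆W y (B⊆Y y y∈B) , ∉⇒≢0 S y∉S)
      ... | inj₁ refl = ⊥-elim (y∉S v∈S)
      ... | inj₂ v<y′ = v<y′

proposition4p3 : (F : FiniteField) (O : FieldOrder F) (n : ℕ) →
    let open Setup F O n in
    (Δ : QComplex) (r : ℕ) → LexShellable Δ r →
    (t : ℕ) (U : ℕ → Subspace) →
    (∀ i → i ≤ t → face Δ (U i)) →
    (∀ i → i < t → U i ⊆ U (suc i)) →
    (∀ i → i ≤ t → HasDim (U i) i) →
    (∀ v → mem (U 0) v → v ≡ zeroV) →
    (∃[ v ] (IsMinVec v (λ w → mem (U t) w × w ≢ zeroV) × mem (U (t ∸ 1)) v)) →
    ∃[ s ] (1 ≤ s × s < t ×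
      IsMinSub (U s) (λ A → U (s ∸ 1) ⊆ A × A ⊆ U (suc s) × HasDim A s))
proposition4p3 F O n Δ r _ zero U _ step dims U₀≡0 (v , ((_ , v≢0) , _) , v∈U₀) = ⊥-elim (v≢0 (U₀≡0 v v∈U₀))
proposition4p3 F O n Δ r _ (suc t) U _ step dims U₀≡0 (v , v-min@((_ , v≢0) , _) , v∈Uₜ)
  with s , s<t , v∉Uₛ , v∈Uₛ₊₁ ← first-entry (λ i → Setup.mem (U i) v) t
         (λ i i<t → mem-dec F O n (U i) (dims i (ℕ.m≤n⇒m≤1+n (ℕ.<⇒≤ i<t))) v)
         (λ v∈U₀ → v≢0 (U₀≡0 v v∈U₀)) v∈Uₜ
  = suc s , s≤s z≤n , s≤s s<t ,
    flag-step-isMin F O n (U s) (U (suc s)) (U (suc (suc s))) (U (suc t))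
      (dims s (ℕ.m≤n⇒m≤1+n (ℕ.<⇒≤ s<t))) (dims (suc s) (ℕ.m≤n⇒m≤1+n s<t))
      (step s (ℕ.m≤n⇒m≤1+n s<t)) (step (suc s) (s≤s s<t))
      (chain-⊆ F O n U (suc t) step (s≤s s<t)) v v-min v∈Uₛ₊₁ v∉Uₛ
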